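{- Let $F$ be a graph. If $(T,\psi)$ is a good $F$-gluing template and $J=J(T,\psi)$, then $e(J)/v(J)=e(F)/v(F)$.
   Context: Graphs are finite and simple; $v(\cdot)$, $e(\cdot)$ count vertices and edges. An $F$-gluing template is a pair $(T,\psi)$ where $T$ is a finite tree and $\psi:V(T)\cup E(T)\to 2^{V(F)}$ satisfies $\psi(st)\subseteq\psi(s)\cap\psi(t)$ for every edge $st$ of $T$. The graph $J(T,\psi)$ is obtained by taking, for each $s\in V(T)$, a copy $F_s$ of the induced subgraph $F[\psi(s)]$, and then, for each edge $st\in E(T)$ and each $v\in\psi(st)$, identifying the vertex of $F_s$ corresponding to $v$ with that of $F_t$ corresponding to $v$. For $S_1,S_2\subseteq V(F)$ write $S_1\sim_F S_2$ if some automorphism $\varphi$ of $F$ has $\varphi(S_1)=S_2$. Consider the real vector space with a basis vector for each $\sim_F$-equivalence class of nonempty subsets of $V(F)$; for $S\subseteq V(F)$ let $\vec e_S$ be the basis vector of the class of $S$ if $S\neq\emptyset$, and $\vec e_\emptyset=\vec 0$. Define $\vec z_{T,\psi}:=\sum_{s\in V(T)}\vec e_{\psi(s)}-\sum_{st\in E(T)}\vec e_{\psi(st)}$ and, for pairwise disjoint $R_1,R_2,R_3\subseteq V(F)$, $\vec x_{R_1,R_2,R_3}:=\vec e_{R_1\cup R_2\cup R_3}-\vec e_{R_2\cup R_3}-\vec e_{R_1\cup R_2}+\vec e_{R_2}$. The template $(T,\psi)$ is good if $e(J(T,\psi))>0$ and $(e(J)/e(F))\vec e_{V(F)}-\vec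 z_{T,\psi}$ is a non-negative linear combination of the vectors $\vec x_{R_1,R_2,R_3}$ over pairwise disjoint $R_1,R_2,R_3\subseteq V(F)$.
   Formalization: In the definition of a good template, the non-negative combination of the vectors $\vec x_{R_1,R_2,R_3}$ has rational coefficients rather than real ones. -}

module Defs where

open import Data.Nat as ℕ using (ℕ; zero; suc; _<_; _≤_; >-nonZero)
open import Data.Bool using (Bool; true; false; _∧_; if_then_else_)
open import Data.Fin using (Fin; zero; suc; inject₁; fromℕ; _<?_)
import Data.Fin
open import Data.Fin.Subset as Sub using (Subset; _∈_; _⊆_; _∩_; _∪_)
open import Data.Fin.Permutation using (Permutation′; _⟨$⟩ʳ_; _⟨$⟩ˡ_)
open import Data.Vec using (lookup; tabulate)
import Data.Vec
import Relation.Nullary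
import Data.Product
open import Data.Vec.Properties using (≡-dec)
open import Data.Bool.Properties using () renaming (_≟_ to _≟B_)
open import Data.Integer using (+_)
open import Data.Rational as ℚ using (ℚ; 0ℚ; 1ℚ; _/_; _≤_)
open import Data.List using (List; []; _∷_)
open import Data.List.Relation.Unary.All using (All)
open import Data.Product using (Σ; _×_; _,_; ∃; ∃-syntax)
open import Data.Empty using (⊥)
open import Function using (_⇔_)
open import Function.Definitions using (Injective)
open import Relation.Binary.PropositionalEquality using (_≡_)
open import Relation.Nullary using (does; ¬_)
open import Relation.Binary.Construct.Closure.Equivalence using (EqClosure)
open import Relation.Binary.Construct.Closure.ReflexiveTransitive using (Star)

sumℕ : (n : ℕ) → (Fin n → ℕ) → ℕ
sumℕ zero    f = 0
sumℕ (suc n) f = f zero ℕ.+ sumℕ n (λ i → f (suc i))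

sumℚ : (n : ℕ) → (Fin n → ℚ) → ℚ
sumℚ zero    f = 0ℚ
sumℚ (suc n) f = f zero ℚ.+ sumℚ n (λ i → f (suc i))

anyFin : (n : ℕ) → (Fin n → Bool) → Bool
anyFin zero    f = false
anyFin (suc n) f = if f zero then true else anyFin n (λ i → f (suc i))

boolToℕ : Bool → ℕ
boolToℕ true  = 1
boolToℕ false = 0

countPairs : (n : ℕ) → (Fin n → Fin n → Bool) → ℕ
countPairs n r = sumℕ n (λ i → sumℕ n (λ j → boolToℕ (does (i <? j) ∧ r i j)))

record SimpleGraph (n : ℕ) : Set where
  field
    adj    : Fin n → Fin n → Bool
    sym    : ∀ u v → adj u v ≡ adj v u
    irrefl : ∀ v → adj v v ≡ false
open SimpleGraph public

vcount : ∀ {n} → SimpleGraph n → ℕ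
vcount {n} _ = n

ecount : ∀ {n} → SimpleGraph n → ℕ
ecount {n} G = countPairs n (adj G)

Adj : ∀ {n} → SimpleGraph n → Fin n → Fin n → Set
Adj G u v = adj G u v ≡ true

Connected : ∀ {n} → SimpleGraph n → Set
Connected G = ∀ u v → Star (Adj G) u v

record Cycle {n : ℕ} (G : SimpleGraph n) : Set where
  field
    len   : ℕ
    vs    : Fin (3 ℕ.+ len) → Fin n
    inj   : Injective _≡_ _≡_ vs
    step  : ∀ (i : Fin (2 ℕ.+ len)) → Adj G (vs (inject₁ i)) (vs (suc i))
    close : Adj G (vs (fromℕ (2 ℕ.+ len))) (vs zero)

Acyclic : ∀ {n} → SimpleGraph n → Set
Acyclic G = ¬ Cycle G

record IsTree {m : ℕ} (T : SimpleGraph m) : Set where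
  field
    nonempty  : 0 < m
    connected : Connected T
    acyclic   : Acyclic T

record GluingTemplate {k : ℕ} (F : SimpleGraph k) : Set where
  field
    m      : ℕ
    T      : SimpleGraph m
    isTree : IsTree T
    ψV     : Fin m → Subset k
    ψE     : Fin m → Fin m → Subset k    -- ψ on edges st of T (only used when st ∈ E(T))
    ψE-sym : ∀ s t → Adj T s t → ψE s t ≡ ψE t s
    ψE⊆    : ∀ s t → Adj T s t → ψE s t ⊆ (ψV s ∩ ψV t)
open GluingTemplate public

-- The graph J(T,ψ).  Its vertices are the classes of pairs (s,v), v ∈ ψ(s),
-- under the equivalence generated by (s,v) ~ (t,v) for st ∈ E(T), v ∈ ψ(st).
module _ {k : ℕ} {F : SimpleGraph k} (τ : GluingTemplate F) where

  data Glue₁ : (Fin (m τ) × Fin k) → (Fin (m τ) × Fin k) → Set where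
    glue : ∀ s t v → Adj (T τ) s t → v ∈ ψE τ s t → Glue₁ (s , v) (t , v)

  -- An explicit presentation of the vertex set of J(T,ψ) as Fin N:
  -- cls sends each (s,v) with v ∈ ψ(s) to its class; classes are identified
  -- exactly according to the gluing equivalence, and every class is hit.
  record JVertices : Set where
    field
      N     : ℕ
      cls   : Fin (m τ) → Fin k → Fin N
      exact : ∀ s t u w → u ∈ ψV τ s → w ∈ ψV τ t →
              (cls s u ≡ cls t w) ⇔ EqClosure Glue₁ (s , u) (t , w)
      onto  : ∀ (i : Fin N) → ∃[ s ] ∃[ u ] (u ∈ ψV τ s × cls s u ≡ i)

  module _ (P : JVertices) where
    open JVertices P

    adjJ : Fin N → Fin N → Bool
    adjJ i j = anyFin (m τ) λ s → anyFin k λ u → anyFin k λ w →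
      lookup (ψV τ s) u ∧ lookup (ψV τ s) w ∧ adj F u w
        ∧ does (cls s u Data.Fin.≟ i) ∧ does (cls s w Data.Fin.≟ j)

    vJ : ℕ
    vJ = N

    eJ : ℕ
    eJ = countPairs N adjJ

-- The paper's space has a basis vector e_[S] for each
-- ∼_F-class [S] of nonempty subsets.  We work in ℚ^{Subset k} (functions
-- Subset k → ℚ, δ_S the indicator of S) and use the canonical linear
-- surjection δ_S ↦ e_S, whose kernel W is spanned by δ_∅ and the vectors
-- δ_S − δ_{φ(S)} for automorphisms φ of F.  Equality in the paper's space is
-- equality modulo W.

_≟S_ : ∀ {k} (S R : Subset k) → Relation.Nullary.Dec (S ≡ R)
_≟S_ = ≡-dec _≟B_

δ : ∀ {k} → Subset k → (Subset k → ℚ)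
δ S R = if does (S ≟S R) then 1ℚ else 0ℚ

record Automorphism {k : ℕ} (F : SimpleGraph k) : Set where
  field
    perm     : Permutation′ k
    preserve : ∀ u v → adj F (perm ⟨$⟩ʳ u) (perm ⟨$⟩ʳ v) ≡ adj F u v
open Automorphism public

image : ∀ {k} {F : SimpleGraph k} → Automorphism F → Subset k → Subset k
image φ S = tabulate (λ i → lookup S (perm φ ⟨$⟩ˡ i))

record DisjTriple (k : ℕ) : Set where
  field
    R₁ R₂ R₃ : Subset k
    d₁₂ : ∀ v → v ∈ R₁ → v ∈ R₂ → ⊥
    d₁₃ : ∀ v → v ∈ R₁ → v ∈ R₃ → ⊥
    d₂₃ : ∀ v → v ∈ R₂ → v ∈ R₃ → ⊥
open DisjTriple public

xvec : ∀ {k} → DisjTriple k → (Subset k → ℚ)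
xvec t R = δ (R₁ t ∪ R₂ t ∪ R₃ t) R ℚ.- δ (R₂ t ∪ R₃ t) R
           ℚ.- δ (R₁ t ∪ R₂ t) R ℚ.+ δ (R₂ t) R

zvec : ∀ {k} {F : SimpleGraph k} → GluingTemplate F → (Subset k → ℚ)
zvec τ R =
  sumℚ (m τ) (λ s → δ (ψV τ s) R)
  ℚ.- sumℚ (m τ) (λ s → sumℚ (m τ) (λ t →
        if does (s <? t) ∧ adj (T τ) s t then δ (ψE τ s t) R else 0ℚ))

sumList : ∀ {A : Set} → (A → ℚ) → List A → ℚ
sumList f []       = 0ℚ
sumList f (a ∷ as) = f a ℚ.+ sumList f as

-- "v is a non-negative linear combination of the vectors x_{R₁,R₂,R₃}",
-- read in the paper's space, i.e. modulo W.
record NonnegCombX {k : ℕ} (F : SimpleGraph k) (v : Subset k → ℚ) : Set where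
  field
    terms   : List (ℚ × DisjTriple k)
    nonneg  : All (λ p → 0ℚ ℚ.≤ Data.Product.proj₁ p) terms
    autTerms : List (ℚ × Subset k × Automorphism F)   -- element of W
    emptyCoeff : ℚ
    equal   : ∀ R →
      v R ≡ sumList (λ { (c , t) → c ℚ.* xvec t R }) terms
            ℚ.+ sumList (λ { (c , S , φ) → c ℚ.* (δ S R ℚ.- δ (image φ S) R) }) autTerms
            ℚ.+ emptyCoeff ℚ.* δ Sub.⊥ R

record Good {k : ℕ} {F : SimpleGraph k} (τ : GluingTemplate F) (P : JVertices τ) : Set where
  field
    eJ-pos : 0 ℕ.< eJ τ P
    -- e(F) > 0 follows from e(J) > 0 (every edge of J is a copy of an edge
    -- of F); it is recorded so that e(J)/e(F) is a well-defined rational.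
    eF-pos : 0 ℕ.< ecount F
    comb   : NonnegCombX F (λ R →
               (_/_ (+ eJ τ P) (ecount F) {{>-nonZero eF-pos}}) ℚ.* δ (Data.Vec.replicate k true) R
               ℚ.- zvec τ R)

module Submission where

-- Apply to the goodness identity the linear functional f ↦ Σ_R |R| f(R).  It vanishes on every
-- x_{R₁,R₂,R₃} (for disjoint sets |R₁∪R₂∪R₃| + |R₂| = |R₂∪R₃| + |R₁∪R₂|), on δ_∅ and on
-- δ_S − δ_φ(S), so it gives (e(J)/e(F))·v(F) = Σ_s |ψ(s)| − Σ_st |ψ(st)|.  The right-hand side
-- is v(J): root T and represent the class of (s,v) by the copy reached by climbing to parents
-- while v stays glued.  As every edge of a tree joins a vertex to its parent, the
-- representatives are exactly the pairs not glued to their parent, and the glued pairs are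
-- counted by Σ_st |ψ(st)|.

open import Defs hiding (sym)
open import Data.Nat using (ℕ)
open import Data.Fin.Subset using (Subset)
open import Data.Vec using (lookup)
open import Relation.Binary.PropositionalEquality using (_≡_)

module NatCast where
  open import Data.Nat as ℕ using (ℕ; zero; suc; NonZero)
  open import Data.Fin using (Fin; zero; suc)
  open import Data.Integer as ℤ using (+_)
  import Data.Integer.Properties as ℤ
  open import Data.Integer.Tactic.RingSolver using (solve-∀)
  open import Data.Rational as ℚ using (ℚ; _/_; toℚᵘ)
  import Data.Rational.Properties as ℚ
  open import Data.Rational.Unnormalised as ℚᵘ using (ℚᵘ; mkℚᵘ; *≡*)
  import Data.Rational.Unnormalised.Properties as ℚᵘ
  open import Relation.Binary.PropositionalEquality

  fromℕ : ℕ → ℚ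
  fromℕ n = + n / 1

  fromℕᵘ : ℕ → ℚᵘ
  fromℕᵘ n = mkℚᵘ (+ n) 0

  toℚᵘ-fromℕ : ∀ n → toℚᵘ (fromℕ n) ℚᵘ.≃ fromℕᵘ n
  toℚᵘ-fromℕ n = ℚ.toℚᵘ-fromℚᵘ (fromℕᵘ n)

  -- ℚ normalises its results, so equations between casts are proved in ℚᵘ, where fromℕᵘ n is
  -- a constructor application.
  ≃-fromℕᵘ⇒≡-fromℕ : ∀ {p} n → toℚᵘ p ℚᵘ.≃ fromℕᵘ n → p ≡ fromℕ n
  ≃-fromℕᵘ⇒≡-fromℕ n eq = ℚ.toℚᵘ-injective (ℚᵘ.≃-trans eq (ℚᵘ.≃-sym (toℚᵘ-fromℕ n)))

  fromℕ-homo-+ : ∀ a b → fromℕ a ℚ.+ fromℕ b ≡ fromℕ (a ℕ.+ b)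
  fromℕ-homo-+ a b = ≃-fromℕᵘ⇒≡-fromℕ (a ℕ.+ b)
    (ℚᵘ.≃-trans (ℚ.toℚᵘ-homo-+ (fromℕ a) (fromℕ b))
    (ℚᵘ.≃-trans (ℚᵘ.+-cong (toℚᵘ-fromℕ a) (toℚᵘ-fromℕ b))
                (*≡* (trans (identity (+ a) (+ b)) (cong (ℤ._* + 1) (sym (ℤ.pos-+ a b)))))))
    where
    identity : ∀ x y → (x ℤ.* + 1 ℤ.+ y ℤ.* + 1) ℤ.* + 1 ≡ (x ℤ.+ y) ℤ.* + 1
    identity = solve-∀

  fromℕ-homo-* : ∀ a b → fromℕ a ℚ.* fromℕ b ≡ fromℕ (a ℕ.* b)
  fromℕ-homo-* a b = ≃-fromℕᵘ⇒≡-fromℕ (a ℕ.* b)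
    (ℚᵘ.≃-trans (ℚ.toℚᵘ-homo-* (fromℕ a) (fromℕ b))
    (ℚᵘ.≃-trans (ℚᵘ.*-cong (toℚᵘ-fromℕ a) (toℚᵘ-fromℕ b))
                (*≡* (cong (ℤ._* + 1) (sym (ℤ.pos-* a b))))))

  m/n*n≡m : ∀ m n .{{_ : NonZero n}} → (+ m / n) ℚ.* fromℕ n ≡ fromℕ m
  m/n*n≡m m n@(suc n-1) = ≃-fromℕᵘ⇒≡-fromℕ m
    (ℚᵘ.≃-trans (ℚ.toℚᵘ-homo-* (+ m / n) (fromℕ n))
    (ℚᵘ.≃-trans (ℚᵘ.*-cong (ℚ.toℚᵘ-fromℚᵘ (mkℚᵘ (+ m) n-1)) (toℚᵘ-fromℕ n))
                (*≡* (identity (+ m) (+ n)))))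
    where
    identity : ∀ x y → (x ℤ.* y) ℤ.* + 1 ≡ x ℤ.* (y ℤ.* + 1)
    identity = solve-∀

  sumℚ-cong : ∀ n {f g : Fin n → ℚ} → (∀ i → f i ≡ g i) → sumℚ n f ≡ sumℚ n g
  sumℚ-cong zero    f≗g = refl
  sumℚ-cong (suc n) f≗g = cong₂ ℚ._+_ (f≗g zero) (sumℚ-cong n (λ i → f≗g (suc i)))

  sumℚ-fromℕ : ∀ n (f : Fin n → ℕ) → sumℚ n (λ i → fromℕ (f i)) ≡ fromℕ (sumℕ n f)
  sumℚ-fromℕ zero    f = refl
  sumℚ-fromℕ (suc n) f =
    trans (cong (fromℕ (f zero) ℚ.+_) (sumℚ-fromℕ n (λ i → f (suc i)))) (fromℕ-homo-+ (f zero) _)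

  fromℕ-injective : ∀ a b → fromℕ a ≡ fromℕ b → a ≡ b
  fromℕ-injective a b eq
    with ℚᵘ.≃-trans (ℚᵘ.≃-sym (toℚᵘ-fromℕ a)) (ℚᵘ.≃-trans (ℚ.toℚᵘ-cong eq) (toℚᵘ-fromℕ b))
  ... | *≡* a*1≡b*1 =
    ℤ.+-injective (trans (sym (ℤ.*-identityʳ (+ a))) (trans a*1≡b*1 (ℤ.*-identityʳ (+ b))))

module FinSums where
  open import Data.Nat using (ℕ; zero; suc; _+_; _*_)
  open import Data.Nat.Properties
    using (+-identityʳ; *-identityˡ; *-identityʳ; *-zeroʳ; *-distribˡ-+; *-distribʳ-+;
           +-commutativeSemigroup)
  open import Algebra.Properties.CommutativeSemigroup +-commutativeSemigroup
    using () renaming (interchange to +-interchange)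
  open import Data.Bool using (Bool; true; false; _∧_)
  open import Data.Fin as Fin using (Fin; zero; suc; _<?_)
  import Data.Fin.Properties as Fin
  open import Data.Product using (_×_; _,_; ∃-syntax; proj₁; proj₂)
  open import Data.Empty using (⊥-elim)
  open import Relation.Binary using (tri<; tri≈; tri>)
  open import Relation.Binary.PropositionalEquality
  open import Relation.Nullary using (Dec; does; ¬_; yes; no)
  open import Relation.Nullary.Decidable using (dec-true; dec-false)
  open import Function using (_∘_)
  open ≡-Reasoning

  sumℕ-cong : ∀ n {f g : Fin n → ℕ} → (∀ i → f i ≡ g i) → sumℕ n f ≡ sumℕ n g
  sumℕ-cong zero    f≗g = refl
  sumℕ-cong (suc n) f≗g = cong₂ _+_ (f≗g zero) (sumℕ-cong n (λ i → f≗g (suc i)))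

  sumℕ-+ : ∀ n (f g : Fin n → ℕ) → sumℕ n (λ i → f i + g i) ≡ sumℕ n f + sumℕ n g
  sumℕ-+ zero    f g = refl
  sumℕ-+ (suc n) f g rewrite sumℕ-+ n (λ i → f (suc i)) (λ i → g (suc i)) =
    +-interchange (f zero) (g zero) (sumℕ n (λ i → f (suc i))) (sumℕ n (λ i → g (suc i)))

  sumℕ-zero : ∀ n {f : Fin n → ℕ} → (∀ i → f i ≡ 0) → sumℕ n f ≡ 0
  sumℕ-zero zero    f≗0 = refl
  sumℕ-zero (suc n) f≗0 rewrite f≗0 zero = sumℕ-zero n (λ i → f≗0 (suc i))

  sumℕ-comm : ∀ a b (f : Fin a → Fin b → ℕ) →
    sumℕ a (λ i → sumℕ b (f i)) ≡ sumℕ b (λ j → sumℕ a (λ i → f i j))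
  sumℕ-comm zero    b f = sym (sumℕ-zero b (λ _ → refl))
  sumℕ-comm (suc a) b f =
    trans (cong (sumℕ b (f zero) +_) (sumℕ-comm a b (λ i → f (suc i))))
          (sym (sumℕ-+ b (f zero) (λ j → sumℕ a (λ i → f (suc i) j))))

  sumℕ-*ˡ : ∀ n c (f : Fin n → ℕ) → sumℕ n (λ i → c * f i) ≡ c * sumℕ n f
  sumℕ-*ˡ zero    c f = sym (*-zeroʳ c)
  sumℕ-*ˡ (suc n) c f rewrite sumℕ-*ˡ n c (λ i → f (suc i)) =
    sym (*-distribˡ-+ c (f zero) _)

  sumℕ-single : ∀ n (f : Fin n → ℕ) i → (∀ j → j ≢ i → f j ≡ 0) → sumℕ n f ≡ f i
  sumℕ-single (suc n) f zero    others≡0 =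
    trans (cong (f zero +_) (sumℕ-zero n (λ j → others≡0 (suc j) λ ())))
          (+-identityʳ (f zero))
  sumℕ-single (suc n) f (suc i) others≡0 rewrite others≡0 zero (λ ()) =
    sumℕ-single n (λ j → f (suc j)) i (λ j j≢i → others≡0 (suc j) (j≢i ∘ Fin.suc-injective))

  sumℕ-ones : ∀ n → sumℕ n (λ _ → 1) ≡ n
  sumℕ-ones zero    = refl
  sumℕ-ones (suc n) = cong suc (sumℕ-ones n)

  boolToℕ-∧ : ∀ a b → boolToℕ (a ∧ b) ≡ boolToℕ a * boolToℕ b
  boolToℕ-∧ true  b = sym (+-identityʳ (boolToℕ b))
  boolToℕ-∧ false b = refl

  boolToℕ-does : ∀ {p} {P : Set p} (P? : Dec P) → P → boolToℕ (does P?) ≡ 1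
  boolToℕ-does (yes _) _ = refl
  boolToℕ-does (no ¬p) p = ⊥-elim (¬p p)

  boolToℕ-does-¬ : ∀ {p} {P : Set p} (P? : Dec P) → ¬ P → boolToℕ (does P?) ≡ 0
  boolToℕ-does-¬ (yes p) ¬p = ⊥-elim (¬p p)
  boolToℕ-does-¬ (no _)  _  = refl

  less : ∀ {n} → Fin n → Fin n → ℕ
  less s t = boolToℕ (does (s <? t))

  less-+-less : ∀ {n} {s t : Fin n} → s ≢ t → less s t + less t s ≡ 1
  less-+-less {s = s} {t} s≢t with Fin.<-cmp s t
  ... | tri< s<t _ _ rewrite dec-true (s <? t) s<t | dec-false (t <? s) (Fin.<-asym s<t) = refl
  ... | tri≈ _ s≡t _ = ⊥-elim (s≢t s≡t)
  ... | tri> _ _ t<s rewrite dec-false (s <? t) (Fin.<-asym t<s) | dec-true (t <? s) t<s = refl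

  sumℕ-upper-triangle : ∀ n (g : Fin n → Fin n → ℕ) → (∀ s → g s s ≡ 0) →
    sumℕ n (λ s → sumℕ n (λ t → less s t * (g s t + g t s))) ≡ sumℕ n (λ s → sumℕ n (g s))
  sumℕ-upper-triangle n g diagonal≡0 = begin
    sumℕ n (λ s → sumℕ n (λ t → less s t * (g s t + g t s)))
      ≡⟨ sumℕ-cong n (λ s → trans (sumℕ-cong n (λ t → *-distribˡ-+ (less s t) _ _))
                                  (sumℕ-+ n _ _)) ⟩
    sumℕ n (λ s → sumℕ n (λ t → less s t * g s t) + sumℕ n (λ t → less s t * g t s))
      ≡⟨ sumℕ-+ n _ _ ⟩
    sumℕ n (λ s → sumℕ n (λ t → less s t * g s t)) + sumℕ n (λ s → sumℕ n (λ t → less s t * g t s))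
      ≡⟨ cong (sumℕ n (λ s → sumℕ n (λ t → less s t * g s t)) +_)
              (sumℕ-comm n n (λ s t → less s t * g t s)) ⟩
    sumℕ n (λ s → sumℕ n (λ t → less s t * g s t)) + sumℕ n (λ t → sumℕ n (λ s → less s t * g t s))
      ≡⟨ sym (sumℕ-+ n _ _) ⟩
    sumℕ n (λ s → sumℕ n (λ t → less s t * g s t) + sumℕ n (λ t → less t s * g s t))
      ≡⟨ sumℕ-cong n (λ s → trans (sym (sumℕ-+ n _ _)) (sumℕ-cong n (both-orientations s))) ⟩
    sumℕ n (λ s → sumℕ n (g s))
      ∎
    where
    both-orientations : ∀ s t → less s t * g s t + less t s * g s t ≡ g s t
    both-orientations s t with s Fin.≟ t
    ... | yes refl rewrite diagonal≡0 s = cong₂ _+_ (*-zeroʳ (less s s)) (*-zeroʳ (less s s))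
    ... | no s≢t = begin
      less s t * g s t + less t s * g s t ≡⟨ sym (*-distribʳ-+ (g s t) (less s t) (less t s)) ⟩
      (less s t + less t s) * g s t       ≡⟨ cong (_* g s t) (less-+-less s≢t) ⟩
      1 * g s t                           ≡⟨ *-identityˡ (g s t) ⟩
      g s t                               ∎

  count-bijection : ∀ a b N (P : Fin a → Fin b → Bool) (f : Fin a → Fin b → Fin N) →
    (∀ s v t w → P s v ≡ true → P t w ≡ true → f s v ≡ f t w → s ≡ t × v ≡ w) →
    (∀ i → ∃[ s ] ∃[ v ] (P s v ≡ true × f s v ≡ i)) →
    sumℕ a (λ s → sumℕ b (λ v → boolToℕ (P s v))) ≡ N
  count-bijection a b N P f injective surjective = begin
    sumℕ a (λ s → sumℕ b (λ v → boolToℕ (P s v)))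
      ≡⟨ sumℕ-cong a (λ s → sumℕ-cong b (λ v → sym (hits-one-class s v))) ⟩
    sumℕ a (λ s → sumℕ b (λ v → sumℕ N (hit s v)))
      ≡⟨ sumℕ-cong a (λ s → sumℕ-comm b N (hit s)) ⟩
    sumℕ a (λ s → sumℕ N (λ i → sumℕ b (λ v → hit s v i)))
      ≡⟨ sumℕ-comm a N (λ s i → sumℕ b (λ v → hit s v i)) ⟩
    sumℕ N (λ i → sumℕ a (λ s → sumℕ b (λ v → hit s v i)))
      ≡⟨ sumℕ-cong N class-hit-once ⟩
    sumℕ N (λ _ → 1)
      ≡⟨ sumℕ-ones N ⟩
    N ∎
    where
    hit : Fin a → Fin b → Fin N → ℕ
    hit s v i = boolToℕ (P s v) * boolToℕ (does (f s v Fin.≟ i))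

    hits-one-class : ∀ s v → sumℕ N (hit s v) ≡ boolToℕ (P s v)
    hits-one-class s v = begin
      sumℕ N (hit s v)
        ≡⟨ sumℕ-*ˡ N (boolToℕ (P s v)) _ ⟩
      boolToℕ (P s v) * sumℕ N (λ i → boolToℕ (does (f s v Fin.≟ i)))
        ≡⟨ cong (boolToℕ (P s v) *_) (sumℕ-single N _ (f s v)
             (λ i i≢fsv → boolToℕ-does-¬ (f s v Fin.≟ i) (i≢fsv ∘ sym))) ⟩
      boolToℕ (P s v) * boolToℕ (does (f s v Fin.≟ f s v))
        ≡⟨ cong (boolToℕ (P s v) *_) (boolToℕ-does (f s v Fin.≟ f s v) refl) ⟩
      boolToℕ (P s v) * 1
        ≡⟨ *-identityʳ (boolToℕ (P s v)) ⟩
      boolToℕ (P s v) ∎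

    misses : ∀ {s v t w} i → P t w ≡ true → f t w ≡ i → ¬ (s ≡ t × v ≡ w) → hit s v i ≡ 0
    misses {s} {v} {t} {w} i Ptw ftw≡i ≢tw with P s v in Psv | f s v Fin.≟ i
    ... | false | _           = refl
    ... | true  | no _        = refl
    ... | true  | yes fsv≡i = ⊥-elim (≢tw (injective s v t w Psv Ptw (trans fsv≡i (sym ftw≡i))))

    class-hit-once : ∀ i → sumℕ a (λ s → sumℕ b (λ v → hit s v i)) ≡ 1
    class-hit-once i with surjective i
    ... | t , w , Ptw , ftw≡i = begin
      sumℕ a (λ s → sumℕ b (λ v → hit s v i))
        ≡⟨ sumℕ-single a _ t (λ s s≢t →
             sumℕ-zero b (λ v → misses i Ptw ftw≡i (s≢t ∘ proj₁))) ⟩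
      sumℕ b (λ v → hit t v i)
        ≡⟨ sumℕ-single b _ w (λ v v≢w → misses i Ptw ftw≡i (v≢w ∘ proj₂)) ⟩
      hit t w i
        ≡⟨ cong₂ _*_ (cong boolToℕ Ptw) (boolToℕ-does (f t w Fin.≟ i) ftw≡i) ⟩
      1 ∎

module Search where
  open import Data.Nat using (ℕ; zero; suc; _<_; s≤s)
  open import Data.Bool using (Bool; true; false; _∧_; _∨_)
  open import Data.Fin using (Fin; zero; suc)
  open import Data.Product using (_×_; _,_; ∃-syntax)
  open import Relation.Binary.PropositionalEquality

  ∧-true⁻ : ∀ {a b} → a ∧ b ≡ true → a ≡ true × b ≡ true
  ∧-true⁻ {true} {true} _ = refl , refl

  ∨-true⁻ʳ : ∀ {a b} → a ≡ false → a ∨ b ≡ true → b ≡ true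
  ∨-true⁻ʳ refl b≡true = b≡true

  anyFin-intro : ∀ n (f : Fin n → Bool) i → f i ≡ true → anyFin n f ≡ true
  anyFin-intro (suc n) f zero    fi rewrite fi = refl
  anyFin-intro (suc n) f (suc i) fi with f zero
  ... | true  = refl
  ... | false = anyFin-intro n (λ j → f (suc j)) i fi

  anyFin-elim : ∀ n (f : Fin n → Bool) → anyFin n f ≡ true → ∃[ i ] f i ≡ true
  anyFin-elim (suc n) f any with f zero in f0
  ... | true  = zero , f0
  ... | false with anyFin-elim n (λ j → f (suc j)) any
  ...   | i , fi = suc i , fi

  least-witness : (f : ℕ → Bool) (n : ℕ) → f n ≡ true →
    ∃[ j ] (f j ≡ true × (∀ i → i < j → f i ≡ false))
  least-witness f n fn with f 0 in f0
  ... | true = 0 , f0 , λ i ()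
  least-witness f zero    fn | false with trans (sym f0) fn
  ... | ()
  least-witness f (suc n) fn | false with least-witness (λ i → f (suc i)) n fn
  ... | j , fj , below-j-false =
    suc j , fj , λ { zero _ → f0 ; (suc i) (s≤s i<j) → below-j-false i i<j }

module VecPaths {A : Set} where
  open import Data.Nat using (zero; suc; _+_)
  open import Data.Fin using (Fin; zero; suc; inject₁; fromℕ)
  open import Data.Vec using (Vec; []; _∷_; _∷ʳ_; lookup)
  open import Data.Vec.Relation.Unary.All using (All; []; _∷_)
  open import Data.Vec.Relation.Unary.AllPairs using (AllPairs; []; _∷_)
  open import Data.Vec.Relation.Unary.Linked using (Linked; []; [-]; _∷_)
  open import Relation.Binary.PropositionalEquality using (_≡_; refl)

  between : ∀ {n} → A → Vec A n → A → Vec A (2 + n)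
  between x inner y = x ∷ (inner ∷ʳ y)

  All-∷ʳ : ∀ {P : A → Set} {n} {xs : Vec A n} {z} → All P xs → P z → All P (xs ∷ʳ z)
  All-∷ʳ []         pz = pz ∷ []
  All-∷ʳ (px ∷ pxs) pz = px ∷ All-∷ʳ pxs pz

  AllPairs-∷ʳ : ∀ {R : A → A → Set} {n} {xs : Vec A n} {z} →
    AllPairs R xs → All (λ x → R x z) xs → AllPairs R (xs ∷ʳ z)
  AllPairs-∷ʳ []           []          = [] ∷ []
  AllPairs-∷ʳ (rx ∷ pairs) (rxz ∷ rxsz) = All-∷ʳ rx rxz ∷ AllPairs-∷ʳ pairs rxsz

  Linked-∷ʳ : ∀ {R : A → A → Set} {n} (xs : Vec A n) {y z} →
    Linked R (xs ∷ʳ y) → R y z → Linked R (xs ∷ʳ y ∷ʳ z)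
  Linked-∷ʳ []           [-]       ryz = ryz ∷ [-]
  Linked-∷ʳ (x ∷ [])     (rxy ∷ l) ryz = rxy ∷ Linked-∷ʳ [] l ryz
  Linked-∷ʳ (x ∷ x′ ∷ xs) (rxx′ ∷ l) ryz = rxx′ ∷ Linked-∷ʳ (x′ ∷ xs) l ryz

  Linked-lookup : ∀ {R : A → A → Set} {n} {xs : Vec A (suc n)} → Linked R xs →
    ∀ i → R (lookup xs (inject₁ i)) (lookup xs (suc i))
  Linked-lookup {xs = x ∷ y ∷ xs} (rxy ∷ l) zero    = rxy
  Linked-lookup {xs = x ∷ y ∷ xs} (rxy ∷ l) (suc i) = Linked-lookup l i

  lookup-∷ʳ-fromℕ : ∀ {n} (xs : Vec A n) {y} → lookup (xs ∷ʳ y) (fromℕ n) ≡ y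
  lookup-∷ʳ-fromℕ []       = refl
  lookup-∷ʳ-fromℕ (x ∷ xs) = lookup-∷ʳ-fromℕ xs

module _ {k : ℕ} {G : SimpleGraph k} where
  open import Data.Fin using (Fin)
  open import Data.Vec using (Vec; _∷_; lookup)
  open import Data.Vec.Relation.Unary.Linked using (Linked)
  open import Data.Vec.Relation.Unary.Unique.Propositional using (Unique)
  open import Data.Vec.Relation.Unary.Unique.Propositional.Properties using (lookup-injective)
  open import Relation.Binary.PropositionalEquality using (subst; sym)
  open VecPaths

  closed-path⇒Cycle : ∀ {n} a b (inner : Vec (Fin k) n) c →
    Linked (Adj G) (a ∷ between b inner c) → Unique (a ∷ between b inner c) → Adj G c a →
    Cycle G
  closed-path⇒Cycle {n} a b inner c linked unique ca = record
    { len   = n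
    ; vs    = lookup (a ∷ between b inner c)
    ; inj   = λ {i} {j} → lookup-injective unique i j
    ; step  = Linked-lookup linked
    ; close = subst (λ v → Adj G v a) (sym (lookup-∷ʳ-fromℕ inner)) ca
    }

module RootedTree {m : ℕ} (T : SimpleGraph m) (isTree : IsTree T) where
  open import Data.Nat using (zero; suc; _≤_; _<_)
  open import Data.Nat.Properties hiding (_≟_)
  open import Data.Bool using (Bool; true; false; _∧_; _∨_)
  open import Data.Bool.Properties using (∨-zeroʳ)
  open import Data.Fin using (Fin; zero; suc; fromℕ<; _≟_)
  open import Data.Vec using (Vec; []; _∷_; _∷ʳ_)
  open import Data.Vec.Relation.Unary.All as All using (All; []; _∷_)
  open import Data.Vec.Relation.Unary.AllPairs using ([]; _∷_)
  open import Data.Vec.Relation.Unary.Linked using (Linked; [-]; _∷_)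
  open import Data.Vec.Relation.Unary.Unique.Propositional using (Unique)
  open import Data.Product using (_×_; _,_; proj₁; proj₂; ∃-syntax)
  open import Data.Sum using (_⊎_; inj₁; inj₂)
  open import Data.Empty using (⊥-elim)
  open import Relation.Binary using (tri<; tri≈; tri>)
  open import Relation.Binary.PropositionalEquality
  open import Relation.Binary.Construct.Closure.ReflexiveTransitive using (Star; ε; _◅_)
  open import Relation.Nullary using (does; ¬_; yes; no)
  open Search
  open VecPaths
  open IsTree isTree

  root : Fin m
  root = fromℕ< nonempty

  Adj-sym : ∀ {a b} → Adj T a b → Adj T b a
  Adj-sym {a} {b} ab = trans (SimpleGraph.sym T b a) ab

  Adj-irrefl : ∀ {a} → ¬ Adj T a a
  Adj-irrefl {a} aa with trans (sym aa) (irrefl T a)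
  ... | ()

  near : ℕ → Fin m → Bool
  near zero    s = does (s ≟ root)
  near (suc n) s = near n s ∨ anyFin m (λ t → near n t ∧ adj T s t)

  near-root : near 0 root ≡ true
  near-root with root ≟ root
  ... | yes _ = refl
  ... | no root≢root = ⊥-elim (root≢root refl)

  near-Adj : ∀ n {a b} → Adj T a b → near n a ≡ true → near (suc n) b ≡ true
  near-Adj n {a} {b} ab near-a =
    trans (cong (near n b ∨_) (anyFin-intro m _ a (cong₂ _∧_ near-a (Adj-sym ab))))
          (∨-zeroʳ (near n b))

  eventually-near : ∀ s → ∃[ n ] near n s ≡ true
  eventually-near s = along (connected s root)
    where
    along : ∀ {a} → Star (Adj T) a root → ∃[ n ] near n a ≡ true
    along ε                = 0 , near-root
    along (ab ◅ b⇝root) with along b⇝root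
    ... | n , near-b = suc n , near-Adj n (Adj-sym ab) near-b

  depth-spec : ∀ s → ∃[ n ] (near n s ≡ true × (∀ i → i < n → near i s ≡ false))
  depth-spec s with eventually-near s
  ... | n , near-s = least-witness (λ i → near i s) n near-s

  opaque
    depth : Fin m → ℕ
    depth s = proj₁ (depth-spec s)

    near-depth : ∀ s → near (depth s) s ≡ true
    near-depth s = proj₁ (proj₂ (depth-spec s))

    depth-least : ∀ s i → i < depth s → near i s ≡ false
    depth-least s = proj₂ (proj₂ (depth-spec s))

  depth-minimal : ∀ s n → near n s ≡ true → depth s ≤ n
  depth-minimal s n near-s with ≤-<-connex (depth s) n
  ... | inj₁ depth≤n = depth≤n
  ... | inj₂ n<depth with trans (sym (depth-least s n n<depth)) near-s
  ...   | ()

  depth≡0⇒root : ∀ {s} → depth s ≡ 0 → s ≡ root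
  depth≡0⇒root {s} depth≡0 with s ≟ root | subst (λ n → near n s ≡ true) depth≡0 (near-depth s)
  ... | yes s≡root | _ = s≡root
  ... | no _       | ()

  depth-root : depth root ≡ 0
  depth-root = n≤0⇒n≡0 (depth-minimal root 0 near-root)

  depth-suc⇒≢root : ∀ {s n} → depth s ≡ suc n → s ≢ root
  depth-suc⇒≢root depth≡suc refl with trans (sym depth≡suc) depth-root
  ... | ()

  depth-Adj : ∀ {a b} → Adj T a b → depth b ≤ suc (depth a)
  depth-Adj {a} {b} ab = depth-minimal b (suc (depth a)) (near-Adj (depth a) ab (near-depth a))

  step-to-root : ∀ s → s ≢ root → ∃[ t ] (Adj T s t × depth s ≡ suc (depth t))
  step-to-root s s≢root with depth s in depth≡ | near-depth s | depth-least s
  ... | zero  | _      | _          = ⊥-elim (s≢root (depth≡0⇒root depth≡))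
  ... | suc n | near-s | not-nearer
    with anyFin-elim m _ (∨-true⁻ʳ (not-nearer n ≤-refl) near-s)
  ...   | t , near-t∧st with ∧-true⁻ near-t∧st
  ...     | near-t , st = t , st , cong suc (≤-antisym n≤depth-t (depth-minimal t n near-t))
    where
    n≤depth-t : n ≤ depth t
    n≤depth-t = ≮⇒≥ λ depth-t<n →
      <-irrefl refl (≤-trans (subst (_≤ suc (depth t)) depth≡ (depth-Adj (Adj-sym st))) depth-t<n)

  parent : Fin m → Fin m
  parent s with s ≟ root
  ... | yes _      = root
  ... | no s≢root = proj₁ (step-to-root s s≢root)

  parent-Adj : ∀ {s} → s ≢ root → Adj T s (parent s)
  parent-Adj {s} s≢root with s ≟ root
  ... | yes s≡root = ⊥-elim (s≢root s≡root)
  ... | no s≢root′ = proj₁ (proj₂ (step-to-root s s≢root′))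

  depth-parent : ∀ {s} → s ≢ root → depth s ≡ suc (depth (parent s))
  depth-parent {s} s≢root with s ≟ root
  ... | yes s≡root = ⊥-elim (s≢root s≡root)
  ... | no s≢root′ = proj₂ (proj₂ (step-to-root s s≢root′))

  record HighPath (h : ℕ) (x y : Fin m) : Set where
    constructor highPath
    field
      {len}  : ℕ
      inner  : Vec (Fin m) len
      linked : Linked (Adj T) (between x inner y)
      unique : Unique (between x inner y)
      high   : All (λ v → h ≤ depth v) (between x inner y)

  shallower⇒≢ : ∀ {z v} → depth z < depth v → z ≢ v
  shallower⇒≢ z<v refl = <-irrefl refl z<v

  depth-parent-pred : ∀ {x h} → depth x ≡ suc h → depth (parent x) ≡ h
  depth-parent-pred depth-x = suc-injective (trans (sym (depth-parent (depth-suc⇒≢root depth-x))) depth-x)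

  ∉-higher : ∀ {h z n} {w : Vec (Fin m) n} → depth z ≡ h → All (λ v → suc h ≤ depth v) w →
    All (z ≢_) w
  ∉-higher depth-z = All.map (λ h<v → shallower⇒≢ (subst (λ d → d < _) (sym depth-z) h<v))

  siblings⇒Cycle : ∀ {h x y} → depth x ≡ suc h → depth y ≡ suc h → parent x ≡ parent y →
    HighPath (suc h) x y → Cycle T
  siblings⇒Cycle {x = x} {y} depth-x depth-y px≡py (highPath inner linked unique high) =
    closed-path⇒Cycle (parent x) x inner y
      (Adj-sym (parent-Adj (depth-suc⇒≢root depth-x)) ∷ linked)
      (∉-higher (depth-parent-pred {x} depth-x) high ∷ unique)
      (subst (Adj T y) (sym px≡py) (parent-Adj (depth-suc⇒≢root depth-y)))

  HighPath-parents : ∀ {h x y} → depth x ≡ suc h → depth y ≡ suc h → parent x ≢ parent y →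
    HighPath (suc h) x y → HighPath h (parent x) (parent y)
  HighPath-parents {h} {x} {y} depth-x depth-y px≢py (highPath inner linked unique high) =
    highPath (x ∷ (inner ∷ʳ y))
      (Adj-sym (parent-Adj (depth-suc⇒≢root depth-x)) ∷
         Linked-∷ʳ (x ∷ inner) linked (parent-Adj (depth-suc⇒≢root depth-y)))
      (All-∷ʳ (∉-higher depth-px high) px≢py ∷
         AllPairs-∷ʳ unique (All.map ≢-sym (∉-higher depth-py high)))
      (≤-reflexive (sym depth-px) ∷
         All-∷ʳ (All.map (≤-trans (n≤1+n h)) high) (≤-reflexive (sym depth-py)))
    where
    depth-px : depth (parent x) ≡ h
    depth-px = depth-parent-pred depth-x
    depth-py : depth (parent y) ≡ h
    depth-py = depth-parent-pred depth-y

  -- Climbing to the parents keeps the path, until two siblings close a cycle.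
  no-level-HighPath : ∀ h {x y} → depth x ≡ h → depth y ≡ h → x ≢ y → ¬ HighPath h x y
  no-level-HighPath zero    depth-x depth-y x≢y _ =
    x≢y (trans (depth≡0⇒root depth-x) (sym (depth≡0⇒root depth-y)))
  no-level-HighPath (suc h) {x} {y} depth-x depth-y _ path with parent x ≟ parent y
  ... | yes px≡py = acyclic (siblings⇒Cycle depth-x depth-y px≡py path)
  ... | no px≢py  = no-level-HighPath h (depth-parent-pred {x} depth-x) (depth-parent-pred {y} depth-y)
                      px≢py (HighPath-parents depth-x depth-y px≢py path)

  child⇒parent : ∀ {a b} → Adj T a b → depth a < depth b → b ≢ root × a ≡ parent b
  child⇒parent {a} {b} ab a<b = b≢root , a≡pb
    where
    depth-b : depth b ≡ suc (depth a)
    depth-b = ≤-antisym (depth-Adj ab) a<b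
    b≢root : b ≢ root
    b≢root = depth-suc⇒≢root depth-b
    depth-pb : depth (parent b) ≡ depth a
    depth-pb = depth-parent-pred depth-b
    a≡pb : a ≡ parent b
    a≡pb with a ≟ parent b
    ... | yes a≡pb = a≡pb
    ... | no a≢pb  = ⊥-elim (no-level-HighPath (depth a) refl depth-pb a≢pb
      (highPath (b ∷ [])
        (ab ∷ parent-Adj b≢root ∷ [-])
        ((shallower⇒≢ a<b ∷ a≢pb ∷ []) ∷
           (≢-sym (shallower⇒≢ (subst (_< depth b) (sym depth-pb) a<b)) ∷ []) ∷ [] ∷ [])
        (≤-refl ∷ <⇒≤ a<b ∷ ≤-reflexive (sym depth-pb) ∷ [])))

  Adj⇒parent : ∀ {a b} → Adj T a b → (a ≢ root × b ≡ parent a) ⊎ (b ≢ root × a ≡ parent b)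
  Adj⇒parent {a} {b} ab with <-cmp (depth a) (depth b)
  ... | tri< a<b _ _ = inj₂ (child⇒parent ab a<b)
  ... | tri> _ _ b<a = inj₁ (child⇒parent (Adj-sym ab) b<a)
  ... | tri≈ _ a≡b _ = ⊥-elim (no-level-HighPath (depth a) refl (sym a≡b) a≢b
          (highPath [] (ab ∷ [-]) ((a≢b ∷ []) ∷ [] ∷ []) (≤-refl ∷ ≤-reflexive a≡b ∷ [])))
    where
    a≢b : a ≢ b
    a≢b refl = Adj-irrefl ab

size : ∀ {k} → Subset k → ℕ
size {k} S = sumℕ k (λ v → boolToℕ (lookup S v))

module GluedVertices {k : ℕ} {F : SimpleGraph k} (τ : GluingTemplate F) (P : JVertices τ) where
  open import Data.Nat using (zero; suc; _+_; _*_)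
  open import Data.Nat.Properties using (suc-injective; +-identityʳ; *-identityʳ; ≤-reflexive; <-asym)
  open import Data.Bool using (Bool; true; false; _∧_; not; if_then_else_)
  open import Data.Bool.Properties using (∧-identityʳ)
  open import Data.Fin using (Fin; _≟_; _<?_)
  open import Data.Fin.Subset using (Subset; _∈_)
  open import Data.Fin.Subset.Properties using (x∈p∩q⁻)
  open import Data.Vec using (lookup)
  open import Data.Vec.Properties using (lookup⇒[]=; []=⇒lookup)
  open import Data.Product using (_×_; _,_; proj₁; proj₂; ∃-syntax)
  open import Data.Sum using (inj₁; inj₂)
  open import Data.Empty using (⊥-elim)
  open import Function using (Equivalence; _∘_)
  open import Relation.Binary.PropositionalEquality
  open import Relation.Binary.Construct.Closure.ReflexiveTransitive using (ε; _◅_)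
  open import Relation.Binary.Construct.Closure.Symmetric using (fwd; bwd)
  open import Relation.Binary.Construct.Closure.Equivalence as EqClosure using (EqClosure)
  open import Relation.Nullary using (does; ¬_; yes; no)
  open FinSums
  open JVertices P
  open RootedTree (T τ) (isTree τ)
  open ≡-Reasoning

  M : ℕ
  M = m τ

  nonRoot : Fin M → Bool
  nonRoot s = not (does (s ≟ root))

  nonRoot-true : ∀ {s} → s ≢ root → nonRoot s ≡ true
  nonRoot-true {s} s≢root with s ≟ root
  ... | yes s≡root = ⊥-elim (s≢root s≡root)
  ... | no _       = refl

  nonRoot⇒≢root : ∀ {s} → nonRoot s ≡ true → s ≢ root
  nonRoot⇒≢root {s} nonRoot-s with s ≟ root
  ... | no s≢root = s≢root

  gluedUp : Fin k → Fin M → Bool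
  gluedUp v s = nonRoot s ∧ lookup (ψE τ s (parent s)) v

  gluedUp⁻ : ∀ {v s} → gluedUp v s ≡ true → s ≢ root × v ∈ ψE τ s (parent s)
  gluedUp⁻ {v} {s} glued with nonRoot s in nonRoot-s
  ... | true = nonRoot⇒≢root nonRoot-s , lookup⇒[]= v (ψE τ s (parent s)) glued

  gluedUp⁺ : ∀ {v s} → s ≢ root → v ∈ ψE τ s (parent s) → gluedUp v s ≡ true
  gluedUp⁺ s≢root v∈ψE rewrite nonRoot-true s≢root = []=⇒lookup v∈ψE

  gluedUp-root : ∀ v → gluedUp v root ≡ false
  gluedUp-root v with root ≟ root
  ... | yes _          = refl
  ... | no root≢root = ⊥-elim (root≢root refl)

  gluedUp⇒∈ψV : ∀ {v s} → gluedUp v s ≡ true → v ∈ ψV τ s × v ∈ ψV τ (parent s)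
  gluedUp⇒∈ψV glued with gluedUp⁻ glued
  ... | s≢root , v∈ψE = x∈p∩q⁻ _ _ (ψE⊆ τ _ _ (parent-Adj s≢root) v∈ψE)

  climb : Fin k → ℕ → Fin M → Fin M
  climb v zero    s = s
  climb v (suc n) s = if gluedUp v s then climb v n (parent s) else s

  -- The representative of the class of (s, v) in V(J); each climbing step lowers the depth, so
  -- depth s steps reach it.
  top : Fin k → Fin M → Fin M
  top v s = climb v (depth s) s

  climb-Glue : ∀ v n s → depth s ≡ n → v ∈ ψV τ s →
    EqClosure (Glue₁ τ) (s , v) (climb v n s , v) × v ∈ ψV τ (climb v n s)
  climb-Glue v zero    s _       v∈ψs = ε , v∈ψs
  climb-Glue v (suc n) s depth-s v∈ψs with gluedUp v s in glued
  ... | false = ε , v∈ψs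
  ... | true with gluedUp⁻ glued
  ...   | s≢root , v∈ψE with climb-Glue v n (parent s)
                               (suc-injective (trans (sym (depth-parent s≢root)) depth-s))
                               (proj₂ (gluedUp⇒∈ψV glued))
  ...     | s′~top , v∈ψtop = fwd (glue s (parent s) v (parent-Adj s≢root) v∈ψE) ◅ s′~top , v∈ψtop

  climb-ends-unglued : ∀ v n s → depth s ≡ n → gluedUp v (climb v n s) ≡ false
  climb-ends-unglued v zero    s depth-s rewrite depth≡0⇒root depth-s = gluedUp-root v
  climb-ends-unglued v (suc n) s depth-s with gluedUp v s in glued
  ... | false = glued
  ... | true  = climb-ends-unglued v n (parent s)
      (suc-injective (trans (sym (depth-parent (proj₁ (gluedUp⁻ glued)))) depth-s))

  climb-unglued : ∀ v n s → gluedUp v s ≡ false → climb v n s ≡ s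
  climb-unglued v zero    s _        = refl
  climb-unglued v (suc n) s unglued rewrite unglued = refl

  top-parent : ∀ {v s} → s ≢ root → v ∈ ψE τ s (parent s) → top v s ≡ top v (parent s)
  top-parent {v} {s} s≢root v∈ψE rewrite depth-parent s≢root | gluedUp⁺ s≢root v∈ψE = refl

  top-Glue₁ : ∀ {v a b} → Adj (T τ) a b → v ∈ ψE τ a b → top v a ≡ top v b
  top-Glue₁ {v} {a} {b} ab v∈ψab with Adj⇒parent ab
  ... | inj₁ (a≢root , b≡pa) =
    trans (top-parent a≢root (subst (λ t → v ∈ ψE τ a t) b≡pa v∈ψab)) (cong (top v) (sym b≡pa))
  ... | inj₂ (b≢root , a≡pb) =
    sym (trans (top-parent b≢root (subst (λ t → v ∈ ψE τ b t) a≡pb (subst (v ∈_) (ψE-sym τ a b ab) v∈ψab)))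
               (cong (top v) (sym a≡pb)))

  top-EqClosure : ∀ {s u t w} → EqClosure (Glue₁ τ) (s , u) (t , w) → u ≡ w × top u s ≡ top u t
  top-EqClosure ε = refl , refl
  top-EqClosure (fwd (glue _ _ _ ab v∈ψE) ◅ rest) with top-EqClosure rest
  ... | refl , top≡ = refl , trans (top-Glue₁ ab v∈ψE) top≡
  top-EqClosure (bwd (glue _ _ _ ab v∈ψE) ◅ rest) with top-EqClosure rest
  ... | refl , top≡ = refl , trans (sym (top-Glue₁ ab v∈ψE)) top≡

  representative : Fin M → Fin k → Bool
  representative s v = lookup (ψV τ s) v ∧ not (gluedUp v s)

  representative⁻ : ∀ {s v} → representative s v ≡ true → v ∈ ψV τ s × gluedUp v s ≡ false
  representative⁻ {s} {v} rep with lookup (ψV τ s) v in v∈ψs | gluedUp v s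
  ... | true | false = lookup⇒[]= v (ψV τ s) v∈ψs , refl

  count-representatives : sumℕ M (λ s → sumℕ k (λ v → boolToℕ (representative s v))) ≡ N
  count-representatives = count-bijection M k N representative cls injective surjective
    where
    injective : ∀ s v t w → representative s v ≡ true → representative t w ≡ true →
                cls s v ≡ cls t w → s ≡ t × v ≡ w
    injective s v t w rep-sv rep-tw same-class
      with representative⁻ rep-sv | representative⁻ rep-tw
    ... | v∈ψs , unglued-s | w∈ψt , unglued-t
      with top-EqClosure (Equivalence.to (exact s t v w v∈ψs w∈ψt) same-class)
    ... | refl , top≡ =
      trans (sym (climb-unglued v (depth s) s unglued-s))
            (trans top≡ (climb-unglued v (depth t) t unglued-t)) , refl

    surjective : ∀ i → ∃[ s ] ∃[ v ] (representative s v ≡ true × cls s v ≡ i)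
    surjective i with onto i
    ... | s , v , v∈ψs , cls≡i with climb-Glue v (depth s) s refl v∈ψs
    ...   | s~top , v∈ψtop =
      top v s , v ,
      cong₂ (λ a b → a ∧ not b) ([]=⇒lookup v∈ψtop) (climb-ends-unglued v (depth s) s refl) ,
      trans (Equivalence.from (exact (top v s) s v v v∈ψtop v∈ψs) (EqClosure.symmetric (Glue₁ τ) s~top))
            cls≡i

  Σψ-vertices : ℕ
  Σψ-vertices = sumℕ M (λ s → size (ψV τ s))

  Σψ-parentEdges : ℕ
  Σψ-parentEdges = sumℕ M (λ s → boolToℕ (nonRoot s) * size (ψE τ s (parent s)))

  Σψ-edges : ℕ
  Σψ-edges = sumℕ M (λ s → sumℕ M (λ t →
    if does (s <? t) ∧ adj (T τ) s t then size (ψE τ s t) else 0))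

  Σψ-vertices≡N+Σψ-parentEdges : Σψ-vertices ≡ N + Σψ-parentEdges
  Σψ-vertices≡N+Σψ-parentEdges = begin
    sumℕ M (λ s → size (ψV τ s))
      ≡⟨ sumℕ-cong M (λ s → trans (sumℕ-cong k (split s)) (sumℕ-+ k _ _)) ⟩
    sumℕ M (λ s → sumℕ k (λ v → boolToℕ (representative s v)) + sumℕ k (λ v → boolToℕ (gluedUp v s)))
      ≡⟨ sumℕ-+ M _ _ ⟩
    sumℕ M (λ s → sumℕ k (λ v → boolToℕ (representative s v)))
      + sumℕ M (λ s → sumℕ k (λ v → boolToℕ (gluedUp v s)))
      ≡⟨ cong₂ _+_ count-representatives (sumℕ-cong M glued-size) ⟩
    N + Σψ-parentEdges ∎
    where
    split : ∀ s v → boolToℕ (lookup (ψV τ s) v) ≡ boolToℕ (representative s v) + boolToℕ (gluedUp v s)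
    split s v with gluedUp v s in glued
    ... | true rewrite []=⇒lookup (proj₁ (gluedUp⇒∈ψV glued)) = refl
    ... | false rewrite ∧-identityʳ (lookup (ψV τ s) v) = sym (+-identityʳ _)

    glued-size : ∀ s → sumℕ k (λ v → boolToℕ (gluedUp v s)) ≡ boolToℕ (nonRoot s) * size (ψE τ s (parent s))
    glued-size s = trans (sumℕ-cong k (λ v → boolToℕ-∧ (nonRoot s) _)) (sumℕ-*ˡ k (boolToℕ (nonRoot s)) _)

  upEdge : Fin M → Fin M → ℕ
  upEdge s t = boolToℕ (nonRoot s ∧ does (t ≟ parent s)) * size (ψE τ s t)

  upEdge-nonParent : ∀ {s t} → ¬ (s ≢ root × t ≡ parent s) → upEdge s t ≡ 0
  upEdge-nonParent {s} {t} not-parent with s ≟ root | t ≟ parent s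
  ... | yes _     | _        = refl
  ... | no s≢root | yes t≡ps = ⊥-elim (not-parent (s≢root , t≡ps))
  ... | no _      | no _     = refl

  upEdge-parent : ∀ {s t} → s ≢ root → t ≡ parent s → upEdge s t ≡ size (ψE τ s t)
  upEdge-parent {s} {t} s≢root t≡ps with s ≟ root | t ≟ parent s
  ... | yes s≡root | _         = ⊥-elim (s≢root s≡root)
  ... | no _       | yes _     = +-identityʳ _
  ... | no _       | no t≢ps  = ⊥-elim (t≢ps t≡ps)

  upEdge-at-parent : ∀ s → upEdge s (parent s) ≡ boolToℕ (nonRoot s) * size (ψE τ s (parent s))
  upEdge-at-parent s = cong (_* size (ψE τ s (parent s)))
    (trans (boolToℕ-∧ (nonRoot s) _)
    (trans (cong (boolToℕ (nonRoot s) *_) (boolToℕ-does (parent s ≟ parent s) refl))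
           (*-identityʳ (boolToℕ (nonRoot s)))))

  parent-asym : ∀ {s t} → s ≢ root → t ≡ parent s → ¬ (t ≢ root × s ≡ parent t)
  parent-asym {s} {t} s≢root refl (t≢root , s≡pt) =
    <-asym (≤-reflexive (sym (depth-parent s≢root)))
           (≤-reflexive (trans (cong (λ u → suc (depth u)) s≡pt) (sym (depth-parent t≢root))))

  upEdge-diagonal : ∀ s → upEdge s s ≡ 0
  upEdge-diagonal s = upEdge-nonParent {s} (λ (s≢root , s≡ps) → parent-asym s≢root s≡ps (s≢root , s≡ps))

  -- Every edge of T is a parent edge seen from exactly one of its ends.
  edge-size-split : ∀ s t →
    (if adj (T τ) s t then size (ψE τ s t) else 0) ≡ upEdge s t + upEdge t s
  edge-size-split s t with adj (T τ) s t in st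
  ... | false = sym (cong₂ _+_ (upEdge-nonParent (not-adjacent st))
                               (upEdge-nonParent (not-adjacent (trans (SimpleGraph.sym (T τ) t s) st))))
    where
    not-adjacent : ∀ {a b} → adj (T τ) a b ≡ false → ¬ (a ≢ root × b ≡ parent a)
    not-adjacent ab≡false (a≢root , refl) with trans (sym ab≡false) (parent-Adj a≢root)
    ... | ()
  ... | true with Adj⇒parent st
  ...   | inj₁ (s≢root , t≡ps) =
    sym (trans (cong₂ _+_ (upEdge-parent s≢root t≡ps) (upEdge-nonParent (parent-asym s≢root t≡ps)))
               (+-identityʳ _))
  ...   | inj₂ (t≢root , s≡pt) =
    sym (trans (cong (upEdge s t +_) (upEdge-parent t≢root s≡pt))
        (trans (cong (_+ size (ψE τ t s)) (upEdge-nonParent (parent-asym t≢root s≡pt)))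
               (cong size (ψE-sym τ t s (Adj-sym st)))))

  Σψ-edges≡Σψ-parentEdges : Σψ-edges ≡ Σψ-parentEdges
  Σψ-edges≡Σψ-parentEdges = begin
    Σψ-edges
      ≡⟨ sumℕ-cong M (λ s → sumℕ-cong M (λ t → ordered-edge s t)) ⟩
    sumℕ M (λ s → sumℕ M (λ t → less s t * (upEdge s t + upEdge t s)))
      ≡⟨ sumℕ-upper-triangle M upEdge upEdge-diagonal ⟩
    sumℕ M (λ s → sumℕ M (upEdge s))
      ≡⟨ sumℕ-cong M (λ s → trans (sumℕ-single M (upEdge s) (parent s)
                                     (λ t t≢ps → upEdge-nonParent {s} (t≢ps ∘ proj₂)))
                                  (upEdge-at-parent s)) ⟩
    Σψ-parentEdges ∎
    where
    ordered-edge : ∀ s t → (if does (s <? t) ∧ adj (T τ) s t then size (ψE τ s t) else 0)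
                           ≡ less s t * (upEdge s t + upEdge t s)
    ordered-edge s t with does (s <? t)
    ... | false = refl
    ... | true  = trans (edge-size-split s t) (sym (+-identityʳ _))

  N+Σψ-edges≡Σψ-vertices : N + Σψ-edges ≡ Σψ-vertices
  N+Σψ-edges≡Σψ-vertices =
    trans (cong (N +_) Σψ-edges≡Σψ-parentEdges) (sym Σψ-vertices≡N+Σψ-parentEdges)

module SizeFunctional {k : ℕ} where
  open import Data.Nat as ℕ using (zero; suc)
  import Data.Nat.Properties as ℕ
  open import Data.Bool using (Bool; true; false; _∨_; if_then_else_)
  open import Data.Fin using (Fin)
  open import Data.Fin.Subset as Subset using (_∪_; _∈_)
  open import Data.Fin.Permutation using (flip)
  open import Data.Vec using ([]; _∷_; replicate)
  open import Data.Vec.Properties using (lookup-replicate; lookup-zipWith; lookup∘tabulate; lookup⇒[]=)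
  open import Data.List using (List; []; _∷_)
  open import Data.Rational using (ℚ; 0ℚ; _+_; _*_; _-_; -_)
  open import Data.Rational.Properties
    using (+-identityˡ; +-identityʳ; *-zeroʳ; *-identityʳ; *-distribˡ-+; neg-distrib-+; +-inverseʳ;
           +-0-commutativeMonoid)
  open import Algebra.Bundles using (CommutativeMonoid)
  open import Algebra.Properties.CommutativeSemigroup
    (CommutativeMonoid.commutativeSemigroup +-0-commutativeMonoid) renaming (interchange to +-interchange)
  open import Data.Rational.Solver using (module +-*-Solver)
  open +-*-Solver using (solve; _:+_; _:*_; :-_; _:-_; _:=_)
  open import Data.Product using (_,_)
  open import Data.Empty using (⊥; ⊥-elim)
  open import Function using (_∘_)
  open import Relation.Binary.PropositionalEquality
  import Algebra.Properties.CommutativeMonoid.Sum ℕ.+-0-commutativeMonoid as ℕSum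
  open NatCast
  open FinSums using (sumℕ-cong; sumℕ-+; sumℕ-zero; sumℕ-ones)
  open ≡-Reasoning

  sumSubsets : ∀ n → (Subset n → ℚ) → ℚ
  sumSubsets zero    f = f []
  sumSubsets (suc n) f = sumSubsets n (f ∘ (true ∷_)) + sumSubsets n (f ∘ (false ∷_))

  sumSubsets-cong : ∀ n {f g : Subset n → ℚ} → (∀ R → f R ≡ g R) → sumSubsets n f ≡ sumSubsets n g
  sumSubsets-cong zero    f≗g = f≗g []
  sumSubsets-cong (suc n) f≗g =
    cong₂ _+_ (sumSubsets-cong n (f≗g ∘ (true ∷_))) (sumSubsets-cong n (f≗g ∘ (false ∷_)))

  sumSubsets-zero : ∀ n → sumSubsets n (λ _ → 0ℚ) ≡ 0ℚ
  sumSubsets-zero zero                               = refl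
  sumSubsets-zero (suc n) rewrite sumSubsets-zero n = refl

  sumSubsets-+ : ∀ n (f g : Subset n → ℚ) →
    sumSubsets n (λ R → f R + g R) ≡ sumSubsets n f + sumSubsets n g
  sumSubsets-+ zero    f g = refl
  sumSubsets-+ (suc n) f g
    rewrite sumSubsets-+ n (f ∘ (true ∷_)) (g ∘ (true ∷_))
          | sumSubsets-+ n (f ∘ (false ∷_)) (g ∘ (false ∷_)) =
    +-interchange (sumSubsets n (f ∘ (true ∷_))) (sumSubsets n (g ∘ (true ∷_)))
                  (sumSubsets n (f ∘ (false ∷_))) (sumSubsets n (g ∘ (false ∷_)))

  sumSubsets-*ˡ : ∀ n c (f : Subset n → ℚ) → sumSubsets n (λ R → c * f R) ≡ c * sumSubsets n f
  sumSubsets-*ˡ zero    c f = refl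
  sumSubsets-*ˡ (suc n) c f
    rewrite sumSubsets-*ˡ n c (f ∘ (true ∷_)) | sumSubsets-*ˡ n c (f ∘ (false ∷_)) =
    sym (*-distribˡ-+ c _ _)

  sumSubsets-neg : ∀ n (f : Subset n → ℚ) → sumSubsets n (λ R → - f R) ≡ - sumSubsets n f
  sumSubsets-neg zero    f = refl
  sumSubsets-neg (suc n) f
    rewrite sumSubsets-neg n (f ∘ (true ∷_)) | sumSubsets-neg n (f ∘ (false ∷_)) =
    sym (neg-distrib-+ (sumSubsets n (f ∘ (true ∷_))) (sumSubsets n (f ∘ (false ∷_))))

  sumSubsets-δ : ∀ n (w : Subset n → ℚ) S → sumSubsets n (λ R → w R * δ S R) ≡ w S
  sumSubsets-δ zero    w []          = *-identityʳ (w [])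
  sumSubsets-δ (suc n) w (true ∷ S)  =
    trans (cong₂ _+_ (sumSubsets-δ n (w ∘ (true ∷_)) S)
                     (trans (sumSubsets-cong n (λ R → *-zeroʳ (w (false ∷ R)))) (sumSubsets-zero n)))
          (+-identityʳ (w (true ∷ S)))
  sumSubsets-δ (suc n) w (false ∷ S) =
    trans (cong₂ _+_ (trans (sumSubsets-cong n (λ R → *-zeroʳ (w (true ∷ R)))) (sumSubsets-zero n))
                     (sumSubsets-δ n (w ∘ (false ∷_)) S))
          (+-identityˡ (w (false ∷ S)))

  sizeSum : (Subset k → ℚ) → ℚ
  sizeSum f = sumSubsets k (λ R → fromℕ (size R) * f R)

  sizeSum-cong : ∀ {f g} → (∀ R → f R ≡ g R) → sizeSum f ≡ sizeSum g
  sizeSum-cong f≗g = sumSubsets-cong k (λ R → cong (fromℕ (size R) *_) (f≗g R))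

  sizeSum-zero : sizeSum (λ _ → 0ℚ) ≡ 0ℚ
  sizeSum-zero = trans (sumSubsets-cong k (λ R → *-zeroʳ (fromℕ (size R)))) (sumSubsets-zero k)

  sizeSum-+ : ∀ f g → sizeSum (λ R → f R + g R) ≡ sizeSum f + sizeSum g
  sizeSum-+ f g =
    trans (sumSubsets-cong k (λ R → *-distribˡ-+ (fromℕ (size R)) (f R) (g R))) (sumSubsets-+ k _ _)

  sizeSum-sub : ∀ f g → sizeSum (λ R → f R - g R) ≡ sizeSum f - sizeSum g
  sizeSum-sub f g =
    trans (sumSubsets-cong k (λ R → distrib (fromℕ (size R)) (f R) (g R)))
    (trans (sumSubsets-+ k _ _) (cong (sizeSum f +_) (sumSubsets-neg k (λ R → fromℕ (size R) * g R))))
    where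
    distrib : ∀ w a b → w * (a - b) ≡ w * a + - (w * b)
    distrib = solve 3 (λ w a b → w :* (a :- b) := w :* a :+ :- (w :* b)) refl

  sizeSum-* : ∀ c f → sizeSum (λ R → c * f R) ≡ c * sizeSum f
  sizeSum-* c f = trans (sumSubsets-cong k (λ R → swap (fromℕ (size R)) c (f R))) (sumSubsets-*ˡ k c _)
    where
    swap : ∀ w c a → w * (c * a) ≡ c * (w * a)
    swap = solve 3 (λ w c a → w :* (c :* a) := c :* (w :* a)) refl

  sizeSum-δ : ∀ S → sizeSum (δ S) ≡ fromℕ (size S)
  sizeSum-δ = sumSubsets-δ k (fromℕ ∘ size)

  sizeSum-if : ∀ (b : Bool) S → sizeSum (λ R → if b then δ S R else 0ℚ) ≡ fromℕ (if b then size S else 0)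
  sizeSum-if true  S = sizeSum-δ S
  sizeSum-if false S = sizeSum-zero

  sizeSum-sumℚ : ∀ n (f : Fin n → Subset k → ℚ) →
    sizeSum (λ R → sumℚ n (λ s → f s R)) ≡ sumℚ n (λ s → sizeSum (f s))
  sizeSum-sumℚ zero    f = sizeSum-zero
  sizeSum-sumℚ (suc n) f =
    trans (sizeSum-+ _ _) (cong (sizeSum (f Fin.zero) +_) (sizeSum-sumℚ n (f ∘ Fin.suc)))
    where import Data.Fin as Fin

  sizeSum-sumList : ∀ {A : Set} (f : A → Subset k → ℚ) (as : List A) →
    (∀ a → sizeSum (f a) ≡ 0ℚ) → sizeSum (λ R → sumList (λ a → f a R) as) ≡ 0ℚ
  sizeSum-sumList f []       _ = sizeSum-zero
  sizeSum-sumList f (a ∷ as) f≡0 =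
    trans (sizeSum-+ _ _) (trans (cong₂ _+_ (f≡0 a) (sizeSum-sumList f as f≡0)) (+-identityˡ 0ℚ))

  size-full : size (replicate k true) ≡ k
  size-full = trans (sumℕ-cong k (λ v → cong boolToℕ (lookup-replicate v true))) (sumℕ-ones k)

  size-⊥ : size {k} Subset.⊥ ≡ 0
  size-⊥ = sumℕ-zero k (λ v → cong boolToℕ (lookup-replicate v false))

  size-image : ∀ {F : SimpleGraph k} (φ : Automorphism F) S → size (image φ S) ≡ size S
  size-image φ S = begin
    size (image φ S)
      ≡⟨ sumℕ-cong k (λ v → cong boolToℕ (lookup∘tabulate _ v)) ⟩
    sumℕ k (λ v → boolToℕ (lookup S (perm φ ⟨$⟩ˡ v)))
      ≡⟨ sumℕ≡sum k _ ⟩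
    ℕSum.sum (λ v → boolToℕ (lookup S (perm φ ⟨$⟩ˡ v)))
      ≡⟨ ℕSum.sum-permute (λ v → boolToℕ (lookup S v)) (flip (perm φ)) ⟨
    ℕSum.sum (λ v → boolToℕ (lookup S v))
      ≡⟨ sumℕ≡sum k _ ⟨
    size S ∎
    where
    open import Data.Fin.Permutation using (_⟨$⟩ˡ_)
    sumℕ≡sum : ∀ n (f : Fin n → ℕ) → sumℕ n f ≡ ℕSum.sum f
    sumℕ≡sum zero    f = refl
    sumℕ≡sum (suc n) f = cong (f Fin.zero ℕ.+_) (sumℕ≡sum n (f ∘ Fin.suc))
      where import Data.Fin as Fin

  size-disjoint : (t : DisjTriple k) →
    size (R₁ t ∪ R₂ t ∪ R₃ t) ℕ.+ size (R₂ t) ≡ size (R₂ t ∪ R₃ t) ℕ.+ size (R₁ t ∪ R₂ t)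
  size-disjoint t = trans (sym (sumℕ-+ k _ _)) (trans (sumℕ-cong k elementwise) (sumℕ-+ k _ _))
    where
    count : ∀ a b c → (a ≡ true → b ≡ true → ⊥) → (a ≡ true → c ≡ true → ⊥) → (b ≡ true → c ≡ true → ⊥) →
      boolToℕ (a ∨ (b ∨ c)) ℕ.+ boolToℕ b ≡ boolToℕ (b ∨ c) ℕ.+ boolToℕ (a ∨ b)
    count true  true  _     a∩b _   _   = ⊥-elim (a∩b refl refl)
    count true  false true  _   a∩c _   = ⊥-elim (a∩c refl refl)
    count true  false false _   _   _   = refl
    count false true  true  _   _   b∩c = ⊥-elim (b∩c refl refl)
    count false true  false _   _   _   = refl
    count false false true  _   _   _   = refl
    count false false false _   _   _   = refl

    ∈ : ∀ {S : Subset k} {v} → lookup S v ≡ true → v ∈ S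
    ∈ {S} {v} = lookup⇒[]= v S

    elementwise : ∀ v →
      boolToℕ (lookup (R₁ t ∪ R₂ t ∪ R₃ t) v) ℕ.+ boolToℕ (lookup (R₂ t) v)
      ≡ boolToℕ (lookup (R₂ t ∪ R₃ t) v) ℕ.+ boolToℕ (lookup (R₁ t ∪ R₂ t) v)
    elementwise v
      rewrite lookup-zipWith _∨_ v (R₁ t) (R₂ t ∪ R₃ t) | lookup-zipWith _∨_ v (R₂ t) (R₃ t)
            | lookup-zipWith _∨_ v (R₁ t) (R₂ t) =
      count (lookup (R₁ t) v) (lookup (R₂ t) v) (lookup (R₃ t) v)
        (λ a b → d₁₂ t v (∈ a) (∈ b)) (λ a c → d₁₃ t v (∈ a) (∈ c)) (λ b c → d₂₃ t v (∈ b) (∈ c))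

  sizeSum-xvec : ∀ t → sizeSum (xvec t) ≡ 0ℚ
  sizeSum-xvec t = begin
    sizeSum (xvec t)
      ≡⟨ sizeSum-+ _ _ ⟩
    sizeSum (λ R → δ A R - δ B R - δ C R) + sizeSum (δ D)
      ≡⟨ cong (_+ sizeSum (δ D)) (trans (sizeSum-sub _ _) (cong (_- sizeSum (δ C)) (sizeSum-sub _ _))) ⟩
    sizeSum (δ A) - sizeSum (δ B) - sizeSum (δ C) + sizeSum (δ D)
      ≡⟨ cong₂ _+_ (cong₂ _-_ (cong₂ _-_ (sizeSum-δ A) (sizeSum-δ B)) (sizeSum-δ C)) (sizeSum-δ D) ⟩
    fromℕ (size A) - fromℕ (size B) - fromℕ (size C) + fromℕ (size D)
      ≡⟨ regroup (fromℕ (size A)) (fromℕ (size B)) (fromℕ (size C)) (fromℕ (size D)) ⟩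
    (fromℕ (size A) + fromℕ (size D)) - (fromℕ (size B) + fromℕ (size C))
      ≡⟨ cong₂ _-_ (fromℕ-homo-+ (size A) (size D)) (fromℕ-homo-+ (size B) (size C)) ⟩
    fromℕ (size A ℕ.+ size D) - fromℕ (size B ℕ.+ size C)
      ≡⟨ cong (λ n → fromℕ n - fromℕ (size B ℕ.+ size C)) (size-disjoint t) ⟩
    fromℕ (size B ℕ.+ size C) - fromℕ (size B ℕ.+ size C)
      ≡⟨ +-inverseʳ (fromℕ (size B ℕ.+ size C)) ⟩
    0ℚ ∎
    where
    A = R₁ t ∪ R₂ t ∪ R₃ t
    B = R₂ t ∪ R₃ t
    C = R₁ t ∪ R₂ t
    D = R₂ t
    regroup : ∀ a b c d → a - b - c + d ≡ (a + d) - (b + c)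
    regroup = solve 4 (λ a b c d → ((a :- b) :- c) :+ d := (a :+ d) :- (b :+ c)) refl

  sizeSum-relabel : ∀ {F : SimpleGraph k} (φ : Automorphism F) S →
    sizeSum (λ R → δ S R - δ (image φ S) R) ≡ 0ℚ
  sizeSum-relabel φ S = begin
    sizeSum (λ R → δ S R - δ (image φ S) R) ≡⟨ sizeSum-sub _ _ ⟩
    sizeSum (δ S) - sizeSum (δ (image φ S)) ≡⟨ cong₂ _-_ (sizeSum-δ S) (sizeSum-δ (image φ S)) ⟩
    fromℕ (size S) - fromℕ (size (image φ S)) ≡⟨ cong (λ n → fromℕ (size S) - fromℕ n) (size-image φ S) ⟩
    fromℕ (size S) - fromℕ (size S)          ≡⟨ +-inverseʳ (fromℕ (size S)) ⟩
    0ℚ ∎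

  sizeSum-NonnegCombX : ∀ {F : SimpleGraph k} {v} → NonnegCombX F v → sizeSum v ≡ 0ℚ
  sizeSum-NonnegCombX {v = v} comb = begin
    sizeSum v
      ≡⟨ sizeSum-cong equal ⟩
    sizeSum (λ R → sumList (λ (c , t) → c * xvec t R) terms
                   + sumList (λ (c , S , φ) → c * (δ S R - δ (image φ S) R)) autTerms
                   + emptyCoeff * δ Subset.⊥ R)
      ≡⟨ trans (sizeSum-+ _ _) (cong₂ _+_ (sizeSum-+ _ _) (sizeSum-* emptyCoeff (δ Subset.⊥))) ⟩
    sizeSum (λ R → sumList (λ (c , t) → c * xvec t R) terms)
      + sizeSum (λ R → sumList (λ (c , S , φ) → c * (δ S R - δ (image φ S) R)) autTerms)
      + emptyCoeff * sizeSum (δ Subset.⊥)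
      ≡⟨ cong₂ _+_ (cong₂ _+_ (sizeSum-sumList _ terms (λ (c , t) → scaled c (sizeSum-xvec t)))
                             (sizeSum-sumList _ autTerms (λ (c , S , φ) → scaled c (sizeSum-relabel φ S))))
                   (cong (emptyCoeff *_) (trans (sizeSum-δ Subset.⊥) (cong fromℕ size-⊥))) ⟩
    0ℚ + 0ℚ + emptyCoeff * 0ℚ
      ≡⟨ cong (0ℚ + 0ℚ +_) (*-zeroʳ emptyCoeff) ⟩
    0ℚ ∎
    where
    open NonnegCombX comb
    scaled : ∀ c {f} → sizeSum f ≡ 0ℚ → sizeSum (λ R → c * f R) ≡ 0ℚ
    scaled c {f} f≡0 = trans (sizeSum-* c f) (trans (cong (c *_) f≡0) (*-zeroʳ c))

module _ {k : ℕ} {F : SimpleGraph k} (τ : GluingTemplate F) (P : JVertices τ) where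
  open import Data.Nat as ℕ using (>-nonZero)
  open import Data.Bool using (true; _∧_; if_then_else_)
  open import Data.Fin using (_<?_)
  open import Data.Integer using (+_)
  open import Data.Rational using (0ℚ; _+_; _*_; _-_; _/_)
  open import Data.Rational.Properties using (+-identityˡ)
  open import Data.Rational.Solver using (module +-*-Solver)
  open +-*-Solver using (solve; _:+_; _:-_; _:=_)
  open import Data.Vec using (replicate)
  open import Relation.Binary.PropositionalEquality
  open import Relation.Nullary using (does)
  open NatCast
  open GluedVertices τ P
  open SizeFunctional {k}
  open ≡-Reasoning

  sizeSum-zvec : sizeSum (zvec τ) ≡ fromℕ Σψ-vertices - fromℕ Σψ-edges
  sizeSum-zvec = trans (sizeSum-sub _ _) (cong₂ _-_ vertex-part edge-part)
    where
    vertex-part : sizeSum (λ R → sumℚ M (λ s → δ (ψV τ s) R)) ≡ fromℕ Σψ-vertices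
    vertex-part = begin
      sizeSum (λ R → sumℚ M (λ s → δ (ψV τ s) R)) ≡⟨ sizeSum-sumℚ M (λ s → δ (ψV τ s)) ⟩
      sumℚ M (λ s → sizeSum (δ (ψV τ s)))         ≡⟨ sumℚ-cong M (λ s → sizeSum-δ (ψV τ s)) ⟩
      sumℚ M (λ s → fromℕ (size (ψV τ s)))        ≡⟨ sumℚ-fromℕ M _ ⟩
      fromℕ Σψ-vertices                           ∎

    edge-part : sizeSum (λ R → sumℚ M (λ s → sumℚ M (λ t →
                  if does (s <? t) ∧ adj (T τ) s t then δ (ψE τ s t) R else 0ℚ))) ≡ fromℕ Σψ-edges
    edge-part =
      trans (sizeSum-sumℚ M _)
      (trans (sumℚ-cong M (λ s →
                trans (sizeSum-sumℚ M _)
                (trans (sumℚ-cong M (λ t → sizeSum-if (does (s <? t) ∧ adj (T τ) s t) (ψE τ s t)))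
                       (sumℚ-fromℕ M _))))
             (sumℚ-fromℕ M _))

  good⇒ratio*k≡vJ : (good : Good τ P) →
    (_/_ (+ eJ τ P) (ecount F) {{>-nonZero (Good.eF-pos good)}}) * fromℕ k ≡ fromℕ (vJ τ P)
  good⇒ratio*k≡vJ good = begin
    q * fromℕ k
      ≡⟨ sym (cancel (q * fromℕ k) (fromℕ N) (fromℕ Σψ-edges)) ⟩
    q * fromℕ k - ((fromℕ N + fromℕ Σψ-edges) - fromℕ Σψ-edges) + fromℕ N
      ≡⟨ cong (λ a → q * fromℕ k - (a - fromℕ Σψ-edges) + fromℕ N)
              (trans (fromℕ-homo-+ N Σψ-edges) (cong fromℕ N+Σψ-edges≡Σψ-vertices)) ⟩
    q * fromℕ k - (fromℕ Σψ-vertices - fromℕ Σψ-edges) + fromℕ N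
      ≡⟨ cong (_+ fromℕ N) balance ⟩
    0ℚ + fromℕ N
      ≡⟨ +-identityˡ (fromℕ N) ⟩
    fromℕ N ∎
    where
    open Good good
    open JVertices P using (N)
    q = _/_ (+ eJ τ P) (ecount F) {{>-nonZero eF-pos}}

    balance : q * fromℕ k - (fromℕ Σψ-vertices - fromℕ Σψ-edges) ≡ 0ℚ
    balance = begin
      q * fromℕ k - (fromℕ Σψ-vertices - fromℕ Σψ-edges)
        ≡⟨ cong₂ _-_ (cong (q *_) (trans (sizeSum-δ (replicate k true)) (cong fromℕ size-full)))
                     sizeSum-zvec ⟨
      q * sizeSum (δ (replicate k true)) - sizeSum (zvec τ)
        ≡⟨ trans (sizeSum-sub _ _) (cong (_- sizeSum (zvec τ)) (sizeSum-* q _)) ⟨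
      sizeSum (λ R → q * δ (replicate k true) R - zvec τ R)
        ≡⟨ sizeSum-NonnegCombX comb ⟩
      0ℚ ∎

    cancel : ∀ x n e → x - ((n + e) - e) + n ≡ x
    cancel = solve 3 (λ x n e → x :- ((n :+ e) :- e) :+ n := x) refl

open import Data.Nat using (_*_; >-nonZero)
open import Data.Integer using (+_)
import Data.Rational as ℚ
open import Data.Rational.Properties using (*-1-commutativeMonoid)
open import Algebra.Bundles using (CommutativeMonoid)
open import Algebra.Properties.CommutativeSemigroup
  (CommutativeMonoid.commutativeSemigroup *-1-commutativeMonoid) using (xy∙z≈y∙xz)
open import Relation.Binary.PropositionalEquality using (cong; module ≡-Reasoning)
open NatCast using (fromℕ; fromℕ-injective; fromℕ-homo-*; m/n*n≡m)

lemma5p10 : ∀ {k : ℕ} (F : SimpleGraph k) (τ : GluingTemplate F) (P : JVertices τ) →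
    Good τ P → eJ τ P * vcount F ≡ ecount F * vJ τ P
lemma5p10 {k} F τ P good = fromℕ-injective _ _ (begin
  fromℕ (eJ τ P * k)                   ≡⟨ fromℕ-homo-* (eJ τ P) k ⟨
  fromℕ (eJ τ P) ℚ.* fromℕ k            ≡⟨ cong (ℚ._* fromℕ k) (m/n*n≡m (eJ τ P) (ecount F)) ⟨
  q ℚ.* fromℕ (ecount F) ℚ.* fromℕ k    ≡⟨ xy∙z≈y∙xz q (fromℕ (ecount F)) (fromℕ k) ⟩
  fromℕ (ecount F) ℚ.* (q ℚ.* fromℕ k)  ≡⟨ cong (fromℕ (ecount F) ℚ.*_) (good⇒ratio*k≡vJ τ P good) ⟩
  fromℕ (ecount F) ℚ.* fromℕ (vJ τ P)   ≡⟨ fromℕ-homo-* (ecount F) (vJ τ P) ⟩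
  fromℕ (ecount F * vJ τ P)             ∎)
  where
  open ≡-Reasoning
  instance _ = >-nonZero (Good.eF-pos good)
  q = + eJ τ P ℚ./ ecount F
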